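{- Let $\mathcal{I}=\langle m_I\mid I\in\Sigma\rangle$, $m_I=\prod_{i\in I}x_i^{\nu_I(i)}$, be a monotone monomial ideal such that the inequality in (MM2) is always strict (i.e. $\nu_I(i)>\nu_J(i)$ whenever $I\subsetneq J$ in $\Sigma$ and $i\in I$) and $\nu_I(i)>0$ for all $I\in\Sigma$, $i\in I$. Then $\mathcal{I}$ is both generic and strictly monotone. In this case the geometrical order complex $\Delta(\Sigma)$ coincides with the geometrical Scarf complex of $\mathcal{I}$, and the homological order complex coincides with the homological Scarf complex of $\mathcal{I}$.
   Context: $\mathbb{K}$ is a field, $S=\mathbb{K}[x_1,\dots,x_n]$, $\Sigma$ a set of nonempty subsets of $\{1,\dots,n\}$ ordered by inclusion. Monotone: (MM1) $m_I$ involves only $x_i$, $i\in I$; (MM2) $\nu_I(i)\ge\nu_J(i)$ for $I\subset J$, $i\in I$; (MM3) for $I,J\in\Sigma$ there is $K\supseteq I\cup J$ in $\Sigma$ with $m_K\mid\mathrm{lcm}(m_I,m_J)$. Strictly monotone: additionally (SM1) no $m_I$ divides $m_J$ for $I\ne J$, and (SM2) for $I\subsetneq J\subsetneq K$ in $\Sigma$ there is $i\in J\setminus I$ with $\nu_J(i)>\nu_K(i)$. A monomial $m$ strictly divides $m'$ if $m\mid m'$ and $\deg_{x_i}(m'/m)\ne0$ whenever $\deg_{x_i}m'\ne0$. A monomial ideal with minimal generators $m_1,\dots,m_r$ is generic if whenever two distinct minimal generators have the same positive degree in some variable, a third generator strictly divides their lcm. For $U$ a set of generators, $m_U$ is their lcm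 and $a_U$ its exponent vector. The geometrical order complex $\Delta(\Sigma)$ is the simplicial complex of nonempty strictly increasing chains in $\Sigma$; the geometrical Scarf complex is $\{U\mid |U|\ge1,\ m_U\neq m_V\text{ for all }V\neq U\}$ (subsets of the set of minimal generators). The homological order complex (resp. homological Scarf complex) is the cellular free complex of $S$-modules supported on the corresponding simplicial complex: its $k$-th term is $\bigoplus_{|F|=k}S(-a_F)$ over $k$-element faces $F$ (with $C_0=S$ for the empty face), $S(-a)=x^aS$, and the differential is the alternating sum of the natural inclusions into the summands of the facets of $F$. -}

module Defs where

open import Data.Nat using (ℕ; zero; suc; _≤_; _<_; _⊔_)
open import Data.Fin using (Fin; zero; suc)
open import Data.Fin.Subset using (Subset; _∈_; _∉_; _⊆_; _⊂_; Nonempty; _∪_)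
  renaming (⊥ to ∅)
open import Data.Product using (Σ; ∃; _×_; _,_)
open import Data.Sum using (_⊎_)
open import Relation.Nullary using (¬_)
open import Relation.Binary.PropositionalEquality using (_≡_; _≢_)
open import Data.Bool using (if_then_else_)
open import Data.Vec using (lookup)

-- A monomial x^a in K[x_1..x_n] is represented by its exponent vector a.
-- (The field K plays no role in the combinatorics of monomials.)
Exp : ℕ → Set
Exp n = Fin n → ℕ

_≈_ : ∀ {n} → Exp n → Exp n → Set
a ≈ b = ∀ i → a i ≡ b i

_∣ₘ_ : ∀ {n} → Exp n → Exp n → Set
a ∣ₘ b = ∀ i → a i ≤ b i

lcm₂ : ∀ {n} → Exp n → Exp n → Exp n
lcm₂ a b i = a i ⊔ b i

StrictlyDivides : ∀ {n} → Exp n → Exp n → Set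
StrictlyDivides a b = a ∣ₘ b × (∀ i → ¬ (b i ≡ 0) → a i < b i)

maxOver : ∀ {m} → (Fin m → ℕ) → ℕ
maxOver {zero} f = 0
maxOver {suc m} f = f zero ⊔ maxOver (λ k → f (suc k))

lcmOf : ∀ {m n} → (Fin m → Exp n) → Subset m → Exp n
lcmOf ν U i = maxOver (λ k → if lookup U k then ν k i else 0)

-- The data: Σ = {σ k | k : Fin m} (σ injective, members nonempty subsets
-- of {1..n}), and m_{σ k} = x^{ν k}.

MM1 : ∀ {m n} → (Fin m → Subset n) → (Fin m → Exp n) → Set
MM1 σ ν = ∀ k i → i ∉ σ k → ν k i ≡ 0

MM2 : ∀ {m n} → (Fin m → Subset n) → (Fin m → Exp n) → Set
MM2 σ ν = ∀ k l → σ k ⊂ σ l → ∀ i → i ∈ σ k → ν l i ≤ ν k i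

MM3 : ∀ {m n} → (Fin m → Subset n) → (Fin m → Exp n) → Set
MM3 σ ν = ∀ k l → ∃ λ p → (σ k ∪ σ l) ⊆ σ p × (ν p ∣ₘ lcm₂ (ν k) (ν l))

IsMonotone : ∀ {m n} → (Fin m → Subset n) → (Fin m → Exp n) → Set
IsMonotone σ ν = MM1 σ ν × MM2 σ ν × MM3 σ ν

StrictMM2 : ∀ {m n} → (Fin m → Subset n) → (Fin m → Exp n) → Set
StrictMM2 σ ν = ∀ k l → σ k ⊂ σ l → ∀ i → i ∈ σ k → ν l i < ν k i

PositiveExponents : ∀ {m n} → (Fin m → Subset n) → (Fin m → Exp n) → Set
PositiveExponents σ ν = ∀ k i → i ∈ σ k → 0 < ν k i

SM1 : ∀ {m n} → (Fin m → Subset n) → (Fin m → Exp n) → Set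
SM1 σ ν = ∀ k l → k ≢ l → ¬ (ν k ∣ₘ ν l)

SM2 : ∀ {m n} → (Fin m → Subset n) → (Fin m → Exp n) → Set
SM2 σ ν = ∀ k l p → σ k ⊂ σ l → σ l ⊂ σ p →
  ∃ λ i → i ∈ σ l × i ∉ σ k × ν p i < ν l i

IsStrictlyMonotone : ∀ {m n} → (Fin m → Subset n) → (Fin m → Exp n) → Set
IsStrictlyMonotone σ ν = IsMonotone σ ν × SM1 σ ν × SM2 σ ν

IsMinGen : ∀ {m n} → (Fin m → Exp n) → Fin m → Set
IsMinGen ν k = ∀ l → ν l ∣ₘ ν k → ν l ≈ ν k

IsGeneric : ∀ {m n} → (Fin m → Exp n) → Set
IsGeneric ν = ∀ k l → IsMinGen ν k → IsMinGen ν l → ¬ (ν k ≈ ν l) →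
  ∀ i → ν k i ≡ ν l i → 0 < ν k i →
  ∃ λ p → IsMinGen ν p × ¬ (ν p ≈ ν k) × ¬ (ν p ≈ ν l) ×
          StrictlyDivides (ν p) (lcm₂ (ν k) (ν l))

OrderFace : ∀ {m n} → (Fin m → Subset n) → Subset m → Set
OrderFace σ U = Nonempty U ×
  (∀ k l → k ∈ U → l ∈ U → k ≢ l → σ k ⊂ σ l ⊎ σ l ⊂ σ k)

ScarfFace : ∀ {m n} → (Fin m → Exp n) → Subset m → Set
ScarfFace ν U = (∀ k → k ∈ U → IsMinGen ν k) × Nonempty U ×
  (∀ V → (∀ k → k ∈ V → IsMinGen ν k) → V ≢ U → ¬ (lcmOf ν V ≈ lcmOf ν U))

SameFaces : ∀ {m} → (Subset m → Set) → (Subset m → Set) → Set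
SameFaces {m} P Q = ∀ (U : Subset m) → (P U → Q U) × (Q U → P U)

-- The cellular free complex supported on a labelled
-- simplicial complex (C_k = ⊕_{|F|=k} S(-a_F), differential = alternating sum
-- of natural inclusions) is completely determined by the set of faces
-- (including the empty face, C_0 = S) together with the multidegree a_F of
-- each face.  We record exactly this data.

record CellularData (m n : ℕ) : Set₁ where
  field
    face  : Subset m → Set
    label : Subset m → Exp n

open CellularData public

HomologicalOrderComplex : ∀ {m n} → (Fin m → Subset n) → (Fin m → Exp n) → CellularData m n
HomologicalOrderComplex σ ν = record
  { face = λ U → U ≡ ∅ ⊎ OrderFace σ U ; label = lcmOf ν }

HomologicalScarfComplex : ∀ {m n} → (Fin m → Exp n) → CellularData m n
HomologicalScarfComplex ν = record
  { face = λ U → U ≡ ∅ ⊎ ScarfFace ν U ; label = lcmOf ν }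

SameCellular : ∀ {m n} → CellularData m n → CellularData m n → Set
SameCellular {m} C D = SameFaces (face C) (face D) ×
  (∀ (U : Subset m) → face C U → label C U ≈ label D U)

-- By (MM1), positivity and strict (MM2), if k is the lowest member of a chain
-- whose support contains the variable i, then every other member of the chain
-- has a strictly smaller exponent of i than k.  Every member has such a
-- variable, so no member can be dropped from a chain without lowering its lcm.
-- Nor can a generator v outside the chain divide that lcm: at a variable of v
-- entering at the least member k above v, the lcm is the exponent of k, which
-- is smaller than that of v.  Hence chains are Scarf faces.  Conversely, for
-- incomparable k, l the (MM3)-witness p lies strictly above both, so toggling p
-- in a face containing k and l changes the face but not its lcm: Scarf faces
-- are chains.  The same p witnesses genericity.
module Submission where

open import Defs
open import Data.Nat using (ℕ; zero; suc; _≤_; _<_; _⊔_; z≤n)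
open import Data.Nat.Properties
  using (≤-refl; ≤-trans; ≤-reflexive; ≤-antisym; <⇒≤; <⇒≱; <-irrefl; <-≤-trans;
         m≤m⊔n; m≤n⊔m; ⊔-lub; ⊔-pres-<m)
open import Data.Fin using (Fin; zero; suc; _≟_)
open import Data.Fin.Properties using (any?)
open import Data.Fin.Subset using (Subset; Nonempty; _∈_; _∉_; _⊆_; _⊂_; _∪_) renaming (⊥ to ∅)
open import Data.Fin.Subset.Properties
  using (_∈?_; _⊂?_; _⊆?_; ⊆-antisym; ⊂-irref; ⊂-⊆-trans; p⊆p∪q; q⊆p∪q)
open import Data.Fin.Subset.Induction using (⊂-wellFounded; ⊃-wellFounded)
open import Data.Vec using (lookup; _[_]≔_)
open import Data.Vec.Properties using ([]=⇒lookup; lookup⇒[]=; lookup∘update; lookup∘update′)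
open import Data.Bool using (true; false; not; if_then_else_)
open import Data.Bool.Properties using (not-¬)
open import Data.Product using (∃; _×_; _,_; proj₁; proj₂)
open import Data.Sum using (_⊎_; inj₁; inj₂) renaming (map to ⊎-map)
open import Data.Empty using (⊥-elim)
open import Function using (id; _∘_)
open import Induction.WellFounded using (WellFounded; Acc; acc)
open import Relation.Binary using (Rel; Decidable)
open import Relation.Binary.Construct.On as On using ()
open import Relation.Nullary using (¬_; yes; no)
open import Relation.Nullary.Decidable using (_×-dec_; ¬?; decidable-stable)
open import Relation.Unary using (Pred) renaming (Decidable to Decidable₁)
open import Relation.Binary.PropositionalEquality using (_≡_; _≢_; refl; sym; trans; cong; subst)

maxOver-closed : ∀ {m} (Q : ℕ → Set) → Q 0 → (∀ {a b} → Q a → Q b → Q (a ⊔ b)) →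
  (f : Fin m → ℕ) → (∀ k → Q (f k)) → Q (maxOver f)
maxOver-closed {zero}  Q q₀ q⊔ f qf = q₀
maxOver-closed {suc m} Q q₀ q⊔ f qf = q⊔ (qf zero) (maxOver-closed Q q₀ q⊔ (f ∘ suc) (qf ∘ suc))

≤-maxOver : ∀ {m} (f : Fin m → ℕ) k → f k ≤ maxOver f
≤-maxOver f zero    = m≤m⊔n _ _
≤-maxOver f (suc k) = ≤-trans (≤-maxOver (f ∘ suc) k) (m≤n⊔m _ _)

module _ {n : ℕ} where

  ⊈⇒∃∉ : {p q : Subset n} → ¬ (p ⊆ q) → ∃ λ x → x ∈ p × x ∉ q
  ⊈⇒∃∉ {p} {q} p⊈q with any? (λ x → (x ∈? p) ×-dec ¬? (x ∈? q))
  ... | yes witness = witness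
  ... | no none     = ⊥-elim (p⊈q λ {x} x∈p → decidable-stable (x ∈? q) (λ x∉q → none (x , x∈p , x∉q)))

  ⊆∧≢⇒⊂ : {p q : Subset n} → p ⊆ q → p ≢ q → p ⊂ q
  ⊆∧≢⇒⊂ p⊆q p≢q = p⊆q , ⊈⇒∃∉ (λ q⊆p → p≢q (⊆-antisym p⊆q q⊆p))

  incomparable⇒⊂-upperBound : {p q r : Subset n} → p ≢ q → ¬ (p ⊂ q) → ¬ (q ⊂ p) →
    p ∪ q ⊆ r → p ⊂ r × q ⊂ r
  incomparable⇒⊂-upperBound {p} {q} {r} p≢q p⊄q q⊄p p∪q⊆r =
    ⊆∧≢⇒⊂ p⊆r (λ { refl → q⊄p (⊆∧≢⇒⊂ q⊆r (p≢q ∘ sym)) }) ,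
    ⊆∧≢⇒⊂ q⊆r (λ { refl → p⊄q (⊆∧≢⇒⊂ p⊆r p≢q) })
    where
    p⊆r : p ⊆ r
    p⊆r = p∪q⊆r ∘ p⊆p∪q q
    q⊆r : q ⊆ r
    q⊆r = p∪q⊆r ∘ q⊆p∪q p q

module _ {m : ℕ} where

  toggle : Subset m → Fin m → Subset m
  toggle U p = U [ p ]≔ not (lookup U p)

  toggle-≢ : ∀ U p → toggle U p ≢ U
  toggle-≢ U p eq = not-¬ (cong (λ V → lookup V p) eq) (lookup∘update p U _)

  ∈-toggle⁺ : ∀ {U p x} → x ≢ p → x ∈ U → x ∈ toggle U p
  ∈-toggle⁺ {U} {x = x} x≢p x∈U = lookup⇒[]= x _ (trans (lookup∘update′ x≢p U _) ([]=⇒lookup x∈U))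

  ∈-toggle⁻ : ∀ {U p x} → x ≢ p → x ∈ toggle U p → x ∈ U
  ∈-toggle⁻ {U} {x = x} x≢p x∈V = lookup⇒[]= x _ (trans (sym (lookup∘update′ x≢p U _)) ([]=⇒lookup x∈V))

  ∃-minimal : ∀ {ℓ r} {R : Rel (Fin m) r} → WellFounded R → Decidable R →
    {P : Pred (Fin m) ℓ} → Decidable₁ P → ∃ P → ∃ λ k → P k × ∀ k' → P k' → ¬ R k' k
  ∃-minimal {R = R} wf R? {P} P? (k₀ , Pk₀) = descend (wf k₀) Pk₀
    where
    descend : ∀ {k} → Acc R k → P k → ∃ λ k → P k × ∀ k' → P k' → ¬ R k' k
    descend {k} (acc smaller) Pk with any? (λ k' → P? k' ×-dec R? k' k)
    ... | yes (k' , Pk' , k'Rk) = descend (smaller k'Rk) Pk'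
    ... | no none                = k , Pk , λ k' Pk' k'Rk → none (k' , Pk' , k'Rk)

module _ {m n} (ν : Fin m → Exp n) where

  lcmOf-closed : (Q : ℕ → Set) → Q 0 → (∀ {a b} → Q a → Q b → Q (a ⊔ b)) →
    ∀ U i → (∀ k → k ∈ U → Q (ν k i)) → Q (lcmOf ν U i)
  lcmOf-closed Q q₀ q⊔ U i qν = maxOver-closed Q q₀ q⊔ _ term
    where
    term : ∀ k → Q (if lookup U k then ν k i else 0)
    term k with lookup U k in eq
    ... | true  = qν k (lookup⇒[]= k U eq)
    ... | false = q₀

  lcmOf-lub : ∀ U i {b} → (∀ k → k ∈ U → ν k i ≤ b) → lcmOf ν U i ≤ b
  lcmOf-lub U i {b} = lcmOf-closed (_≤ b) z≤n ⊔-lub U i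

  lcmOf-<-lub : ∀ U i {b} → 0 < b → (∀ k → k ∈ U → ν k i < b) → lcmOf ν U i < b
  lcmOf-<-lub U i {b} 0<b = lcmOf-closed (_< b) 0<b ⊔-pres-<m U i

  ∈⇒≤-lcmOf : ∀ {U k} i → k ∈ U → ν k i ≤ lcmOf ν U i
  ∈⇒≤-lcmOf {U} {k} i k∈U =
    ≤-trans (≤-reflexive (cong (λ b → if b then ν k i else 0) (sym ([]=⇒lookup k∈U)))) (≤-maxOver _ k)

  lcmOf-∣-redundant : ∀ {W W' p k l} → (∀ x → x ≢ p → x ∈ W → x ∈ W') → k ∈ W' → l ∈ W' →
    ν p ∣ₘ lcm₂ (ν k) (ν l) → lcmOf ν W ∣ₘ lcmOf ν W'
  lcmOf-∣-redundant {W} {W'} {p} W⊆W' k∈W' l∈W' νp∣ i = lcmOf-lub W i bound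
    where
    bound : ∀ x → x ∈ W → ν x i ≤ lcmOf ν W' i
    bound x x∈W with x ≟ p
    ... | yes refl = ≤-trans (νp∣ i) (⊔-lub (∈⇒≤-lcmOf i k∈W') (∈⇒≤-lcmOf i l∈W'))
    ... | no x≢p   = ∈⇒≤-lcmOf i (W⊆W' x x≢p x∈W)

  lcmOf-toggle-redundant : ∀ {U p k l} → k ∈ U → l ∈ U → k ≢ p → l ≢ p →
    ν p ∣ₘ lcm₂ (ν k) (ν l) → lcmOf ν (toggle U p) ≈ lcmOf ν U
  lcmOf-toggle-redundant k∈U l∈U k≢p l≢p νp∣ i = ≤-antisym
    (lcmOf-∣-redundant (λ _ → ∈-toggle⁻) k∈U l∈U νp∣ i)
    (lcmOf-∣-redundant (λ _ → ∈-toggle⁺) (∈-toggle⁺ k≢p k∈U) (∈-toggle⁺ l≢p l∈U) νp∣ i)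

module _ {m n} (σ : Fin m → Subset n) where

  IsChain : Subset m → Set
  IsChain U = ∀ k l → k ∈ U → l ∈ U → k ≢ l → σ k ⊂ σ l ⊎ σ l ⊂ σ k

  ∃-⊂-minimal : ∀ {ℓ} {P : Pred (Fin m) ℓ} → Decidable₁ P → ∃ P →
    ∃ λ k → P k × ∀ k' → P k' → ¬ (σ k' ⊂ σ k)
  ∃-⊂-minimal = ∃-minimal (On.wellFounded σ ⊂-wellFounded) (λ a b → σ a ⊂? σ b)

  ∃-⊂-maximal : ∀ {ℓ} {P : Pred (Fin m) ℓ} → Decidable₁ P → ∃ P →
    ∃ λ k → P k × ∀ k' → P k' → ¬ (σ k ⊂ σ k')
  ∃-⊂-maximal = ∃-minimal (On.wellFounded σ ⊃-wellFounded) (λ a b → σ b ⊂? σ a)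

  chain-⊆ : ∀ {U k k'} → IsChain U → k ∈ U → k' ∈ U → ¬ (σ k' ⊂ σ k) → σ k ⊆ σ k'
  chain-⊆ {k = k} {k'} chain k∈U k'∈U k'⊄k with k ≟ k'
  ... | yes refl = id
  ... | no k≢k' with chain k k' k∈U k'∈U k≢k'
  ...   | inj₁ k⊂k' = proj₁ k⊂k'
  ...   | inj₂ k'⊂k = ⊥-elim (k'⊄k k'⊂k)

  FirstIn : Subset m → Fin m → Fin n → Set
  FirstIn U k i = ∀ k' → k' ∈ U → i ∈ σ k' → σ k ⊆ σ k'

  ∃-avoiding-below : ∀ {U k} {S : Subset n} → IsChain U → Nonempty S →
    (∀ k' → k' ∈ U → σ k' ⊂ σ k → ¬ (S ⊆ σ k')) →
    ∃ λ i → i ∈ S × ∀ k' → k' ∈ U → σ k' ⊂ σ k → i ∉ σ k'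
  ∃-avoiding-below {U} {k} chain (i₀ , i₀∈S) S⊈below with any? (λ k' → (k' ∈? U) ×-dec (σ k' ⊂? σ k))
  ... | no none = i₀ , i₀∈S , λ k' k'∈U k'⊂k → ⊥-elim (none (k' , k'∈U , k'⊂k))
  ... | yes below with ∃-⊂-maximal (λ k' → (k' ∈? U) ×-dec (σ k' ⊂? σ k)) below
  ...   | (k'' , (k''∈U , k''⊂k) , k''-max) with ⊈⇒∃∉ (S⊈below k'' k''∈U k''⊂k)
  ...     | (i , i∈S , i∉k'') =
    i , i∈S , λ k' k'∈U k'⊂k i∈k' → i∉k'' (chain-⊆ chain k'∈U k''∈U (k''-max k' (k'∈U , k'⊂k)) i∈k')

  ∃-FirstIn : ∀ {U k} {S : Subset n} → IsChain U → k ∈ U → Nonempty S →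
    (∀ k' → k' ∈ U → σ k' ⊂ σ k → ¬ (S ⊆ σ k')) →
    ∃ λ i → i ∈ S × FirstIn U k i
  ∃-FirstIn chain k∈U S≢∅ S⊈below with ∃-avoiding-below chain S≢∅ S⊈below
  ... | (i , i∈S , avoids) =
    i , i∈S , λ k' k'∈U i∈k' → chain-⊆ chain k∈U k'∈U (λ k'⊂k → avoids k' k'∈U k'⊂k i∈k')

module _ {m n} {σ : Fin m → Subset n} {ν : Fin m → Exp n} where

  positive⇒∈ : MM1 σ ν → ∀ {k i} → 0 < ν k i → i ∈ σ k
  positive⇒∈ mm1 {k} {i} 0<νki with i ∈? σ k
  ... | yes i∈k = i∈k
  ... | no i∉k  = ⊥-elim (<-irrefl (sym (mm1 k i i∉k)) 0<νki)

  lcmOf-support : MM1 σ ν → ∀ {U i} → 0 < lcmOf ν U i → ∃ λ k → k ∈ U × i ∈ σ k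
  lcmOf-support mm1 {U} {i} 0<lcm with any? (λ k → (k ∈? U) ×-dec (i ∈? σ k))
  ... | yes witness = witness
  ... | no none     = ⊥-elim (<⇒≱ 0<lcm (lcmOf-lub ν U i λ k k∈U →
                        ≤-reflexive (mm1 k i (λ i∈k → none (k , k∈U , i∈k)))))

  strictMM2⇒SM2 : StrictMM2 σ ν → SM2 σ ν
  strictMM2⇒SM2 strict k l p (_ , i , i∈l , i∉k) l⊂p = i , i∈l , i∉k , strict l p l⊂p i i∈l

  SM1⇒IsMinGen : SM1 σ ν → ∀ k → IsMinGen ν k
  SM1⇒IsMinGen sm1 k l νl∣νk with l ≟ k
  ... | yes refl = λ _ → refl
  ... | no l≢k   = ⊥-elim (sm1 l k l≢k νl∣νk)

  generic : (∀ k l → σ k ≡ σ l → k ≡ l) → MM1 σ ν → MM3 σ ν → StrictMM2 σ ν →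
    (∀ k → IsMinGen ν k) → IsGeneric ν
  generic injective mm1 mm3 strict minGen k l _ _ νk≉νl i νki≡νli 0<νki with mm3 k l
  ... | (p , k∪l⊆p , νp∣lcm) = p , minGen p , νp≉νk , νp≉νl , νp∣lcm , strictly
    where
    i∈k : i ∈ σ k
    i∈k = positive⇒∈ mm1 0<νki
    i∈l : i ∈ σ l
    i∈l = positive⇒∈ mm1 (subst (0 <_) νki≡νli 0<νki)
    k⊂p×l⊂p : σ k ⊂ σ p × σ l ⊂ σ p
    k⊂p×l⊂p = incomparable⇒⊂-upperBound
      (λ σk≡σl → νk≉νl (λ j → cong (λ a → ν a j) (injective k l σk≡σl)))
      (λ k⊂l → <-irrefl (sym νki≡νli) (strict k l k⊂l i i∈k))
      (λ l⊂k → <-irrefl νki≡νli (strict l k l⊂k i i∈l))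
      k∪l⊆p
    k⊂p : σ k ⊂ σ p
    k⊂p = proj₁ k⊂p×l⊂p
    l⊂p : σ l ⊂ σ p
    l⊂p = proj₂ k⊂p×l⊂p
    νp≉νk : ¬ (ν p ≈ ν k)
    νp≉νk e = <-irrefl (e i) (strict k p k⊂p i i∈k)
    νp≉νl : ¬ (ν p ≈ ν l)
    νp≉νl e = <-irrefl (e i) (strict l p l⊂p i i∈l)
    strictly : ∀ j → lcm₂ (ν k) (ν l) j ≢ 0 → ν p j < lcm₂ (ν k) (ν l) j
    strictly j lcm≢0 with j ∈? σ k | j ∈? σ l
    ... | yes j∈k | _       = <-≤-trans (strict k p k⊂p j j∈k) (m≤m⊔n _ _)
    ... | no _    | yes j∈l = <-≤-trans (strict l p l⊂p j j∈l) (m≤n⊔m _ _)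
    ... | no j∉k  | no j∉l  = ⊥-elim (lcm≢0 (trans (cong (_⊔ ν l j) (mm1 k j j∉k)) (mm1 l j j∉l)))

  scarf⇒chain : (∀ k l → σ k ≡ σ l → k ≡ l) → MM3 σ ν → (∀ k → IsMinGen ν k) →
    ∀ {U} → ScarfFace ν U → OrderFace σ U
  scarf⇒chain injective mm3 minGen {U} (_ , U≢∅ , scarf) = U≢∅ , chain
    where
    chain : IsChain σ U
    chain k l k∈U l∈U k≢l with σ k ⊂? σ l | σ l ⊂? σ k
    ... | yes k⊂l | _       = inj₁ k⊂l
    ... | no _    | yes l⊂k = inj₂ l⊂k
    ... | no k⊄l  | no l⊄k  with mm3 k l
    ...   | (p , k∪l⊆p , νp∣lcm) with incomparable⇒⊂-upperBound (k≢l ∘ injective k l) k⊄l l⊄k k∪l⊆p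
    ...     | (k⊂p , l⊂p) =
      ⊥-elim (scarf (toggle U p) (λ x _ → minGen x) (toggle-≢ U p)
            (lcmOf-toggle-redundant ν k∈U l∈U (λ { refl → ⊂-irref refl k⊂p })
                                               (λ { refl → ⊂-irref refl l⊂p }) νp∣lcm))

module _ {m n} {σ : Fin m → Subset n} {ν : Fin m → Exp n}
  (injective : ∀ k l → σ k ≡ σ l → k ≡ l) (nonempty : ∀ k → Nonempty (σ k))
  (mm1 : MM1 σ ν) (strict : StrictMM2 σ ν) (positive : PositiveExponents σ ν) where

  ⊆∧≢⇒σ⊂ : ∀ {k l} → σ k ⊆ σ l → k ≢ l → σ k ⊂ σ l
  ⊆∧≢⇒σ⊂ {k} {l} k⊆l k≢l = ⊆∧≢⇒⊂ k⊆l (k≢l ∘ injective k l)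

  strictMM2⇒SM1 : SM1 σ ν
  strictMM2⇒SM1 k l k≢l νk∣νl = <⇒≱ (strict k l (⊆∧≢⇒σ⊂ k⊆l k≢l) i i∈k) (νk∣νl i)
    where
    i : Fin n
    i = proj₁ (nonempty k)
    i∈k : i ∈ σ k
    i∈k = proj₂ (nonempty k)
    k⊆l : σ k ⊆ σ l
    k⊆l {x} x∈k = positive⇒∈ mm1 (<-≤-trans (positive k x x∈k) (νk∣νl x))

  FirstIn⇒dominates : ∀ {U k k' i} → FirstIn σ U k i → i ∈ σ k → k' ∈ U → k' ≢ k → ν k' i < ν k i
  FirstIn⇒dominates {k = k} {k'} {i} first i∈k k'∈U k'≢k with i ∈? σ k'
  ... | yes i∈k' = strict k k' (⊆∧≢⇒σ⊂ (first k' k'∈U i∈k') (k'≢k ∘ sym)) i i∈k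
  ... | no i∉k'  = subst (_< ν k i) (sym (mm1 k' i i∉k')) (positive k i i∈k)

  lcmOf-≤-FirstIn : ∀ {U W k i} → FirstIn σ U k i → i ∈ σ k → W ⊆ U → lcmOf ν W i ≤ ν k i
  lcmOf-≤-FirstIn {W = W} {k} {i} first i∈k W⊆U = lcmOf-lub ν W i dominated
    where
    dominated : ∀ k' → k' ∈ W → ν k' i ≤ ν k i
    dominated k' k'∈W with k' ≟ k
    ... | yes refl = ≤-refl
    ... | no k'≢k  = <⇒≤ (FirstIn⇒dominates first i∈k (W⊆U k'∈W) k'≢k)

  lcmOf-<-FirstIn : ∀ {U W k i} → FirstIn σ U k i → i ∈ σ k → W ⊆ U → k ∉ W → lcmOf ν W i < ν k i
  lcmOf-<-FirstIn {W = W} {k} {i} first i∈k W⊆U k∉W =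
    lcmOf-<-lub ν W i (positive k i i∈k)
      (λ k' k'∈W → FirstIn⇒dominates first i∈k (W⊆U k'∈W) (λ { refl → k∉W k'∈W }))

  ∣ₘlcmOf-chain⇒∈ : ∀ {U v} → IsChain σ U → Nonempty U → ν v ∣ₘ lcmOf ν U → v ∈ U
  ∣ₘlcmOf-chain⇒∈ {U} {v} chain U≢∅ νv∣lcm with ∃-⊂-maximal σ (_∈? U) U≢∅
  ... | (top , top∈U , top-max)
      with ∃-⊂-minimal σ (λ a → (a ∈? U) ×-dec (σ v ⊆? σ a)) (top , top∈U , v⊆top)
    where
    v⊆top : σ v ⊆ σ top
    v⊆top {x} x∈v with lcmOf-support mm1 (<-≤-trans (positive v x x∈v) (νv∣lcm x))
    ... | (k , k∈U , x∈k) = chain-⊆ σ chain k∈U top∈U (top-max k k∈U) x∈k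
  ... | (k , (k∈U , v⊆k) , k-min) with ∃-FirstIn σ chain k∈U (nonempty v)
                                         (λ k' k'∈U k'⊂k v⊆k' → k-min k' (k'∈U , v⊆k') k'⊂k)
  ...   | (i , i∈v , first) with v ≟ k
  ...     | yes refl = k∈U
  ...     | no v≢k   = ⊥-elim (<⇒≱ (strict v k (⊆∧≢⇒σ⊂ v⊆k v≢k) i i∈v)
                                   (≤-trans (νv∣lcm i) (lcmOf-≤-FirstIn first (v⊆k i∈v) id)))

  chain⇒scarf : ∀ {U} → OrderFace σ U → ScarfFace ν U
  chain⇒scarf {U} (U≢∅ , chain) = (λ k _ → SM1⇒IsMinGen {σ = σ} strictMM2⇒SM1 k) , U≢∅ , scarf
    where
    scarf : ∀ V → (∀ k → k ∈ V → IsMinGen ν k) → V ≢ U → ¬ (lcmOf ν V ≈ lcmOf ν U)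
    scarf V _ V≢U lcmV≈lcmU = V≢U (⊆-antisym V⊆U U⊆V)
      where
      V⊆U : V ⊆ U
      V⊆U v∈V =
        ∣ₘlcmOf-chain⇒∈ chain U≢∅ (λ i → ≤-trans (∈⇒≤-lcmOf ν i v∈V) (≤-reflexive (lcmV≈lcmU i)))
      U⊆V : U ⊆ V
      U⊆V {k} k∈U with k ∈? V
      ... | yes k∈V = k∈V
      ... | no k∉V
          with ∃-FirstIn σ chain k∈U (nonempty k) (λ _ _ k'⊂k k⊆k' → ⊂-irref refl (⊂-⊆-trans k'⊂k k⊆k'))
      ...   | (i , i∈k , first) = ⊥-elim (<⇒≱ (lcmOf-<-FirstIn first i∈k V⊆U k∉V)
                                             (≤-trans (∈⇒≤-lcmOf ν i k∈U) (≤-reflexive (sym (lcmV≈lcmU i)))))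

cellular-cong : ∀ {m n} {P Q : Subset m → Set} (label : Subset m → Exp n) → SameFaces P Q →
  SameCellular (record { face = λ U → U ≡ ∅ ⊎ P U ; label = label })
               (record { face = λ U → U ≡ ∅ ⊎ Q U ; label = label })
cellular-cong label same = (λ U → ⊎-map id (proj₁ (same U)) , ⊎-map id (proj₂ (same U))) , λ _ _ _ → refl

proposition6p7 : (n m : ℕ) (σ : Fin m → Subset n) (ν : Fin m → Exp n) →
    (∀ k l → σ k ≡ σ l → k ≡ l) →
    (∀ k → Nonempty (σ k)) →
    IsMonotone σ ν →
    StrictMM2 σ ν →
    PositiveExponents σ ν →
    IsGeneric ν × IsStrictlyMonotone σ ν ×
    SameFaces (OrderFace σ) (ScarfFace ν) ×
    SameCellular (HomologicalOrderComplex σ ν) (HomologicalScarfComplex ν)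
proposition6p7 _ _ σ ν injective nonempty monotone@(mm1 , _ , mm3) strict positive =
  generic injective mm1 mm3 strict minGen ,
  (monotone , sm1 , strictMM2⇒SM2 strict) ,
  sameFaces ,
  cellular-cong (lcmOf ν) sameFaces
  where
  sm1 : SM1 σ ν
  sm1 = strictMM2⇒SM1 injective nonempty mm1 strict positive
  minGen : ∀ k → IsMinGen ν k
  minGen = SM1⇒IsMinGen {σ = σ} sm1
  sameFaces : SameFaces (OrderFace σ) (ScarfFace ν)
  sameFaces U = chain⇒scarf injective nonempty mm1 strict positive ,
                scarf⇒chain injective mm3 minGen
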